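{- Let $\lambda\in\mathbb{C}_p$ with $\lambda\ne0$ and $|\lambda|_p\le1$ ($p$ an odd prime), and let $r\in\mathbb{N}$. For every $n\ge0$, \[ \mathcal{E}^{(r)}_{n,\lambda}(x)=\sum_{m=0}^nCh^{(r)}_{m,\lambda}(x)\,S_2(n,m). \]
   Context: $S_2(n,m)$ are the Stirling numbers of the second kind: $x^n=\sum_{m=0}^nS_2(n,m)\,x(x-1)\cdots(x-m+1)$. Write $(x)_{0,\lambda}=1$, $(x)_{n,\lambda}=x(x-\lambda)\cdots(x-(n-1)\lambda)$, and $(1+\lambda u)^{x/\lambda}=\sum_{m\ge0}(x)_{m,\lambda}u^m/m!$. Higher-order degenerate Changhee polynomials of the second kind: $\left(\frac{2}{1+(1+\lambda\log(1+t))^{1/\lambda}}\right)^r(1+\lambda\log(1+t))^{x/\lambda}=\sum_{n\ge0}Ch^{(r)}_{n,\lambda}(x)\frac{t^n}{n!}$. Carlitz's degenerate Euler polynomials of order $r$: $\left(\frac{2}{(1+\lambda t)^{1/\lambda}+1}\right)^r(1+\lambda t)^{x/\lambda}=\sum_{n\ge0}\mathcal{E}^{(r)}_{n,\lambda}(x)\frac{t^n}{n!}$. -}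

module Defs where

open import Level using (Level; _⊔_)
open import Data.Nat as ℕ using (ℕ; zero; suc; _∸_)
open import Algebra.Bundles using (CommutativeRing)
open import Relation.Nullary using (¬_)

ιR : ∀ {c ℓ} (R : CommutativeRing c ℓ) → ℕ → CommutativeRing.Carrier R
ιR R zero    = CommutativeRing.0# R
ιR R (suc n) = CommutativeRing._+_ R (ιR R n) (CommutativeRing.1# R)

-- A field of characteristic zero (the paper works in ℂ_p, which is such a field;
-- agda-stdlib has no Field bundle, so we package one here).
record CharZeroField (c ℓ : Level) : Set (Level.suc (c ⊔ ℓ)) where
  field
    commRing : CommutativeRing c ℓ
  open CommutativeRing commRing public
  field
    _⁻¹       : Carrier → Carrier
    ⁻¹-inverse : ∀ a → ¬ (a ≈ 0#) → a * (a ⁻¹) ≈ 1#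
    char-zero : ∀ k → ¬ (ιR commRing (suc k) ≈ 0#)

module _ {c ℓ : Level} (F : CharZeroField c ℓ) where
  open CharZeroField F

  ι : ℕ → Carrier
  ι n = ιR commRing n

  sumTo : ℕ → (ℕ → Carrier) → Carrier
  sumTo zero    f = f 0
  sumTo (suc n) f = sumTo n f + f (suc n)

  fact : ℕ → Carrier
  fact zero    = 1#
  fact (suc n) = fact n * ι (suc n)

  two : Carrier
  two = 1# + 1#

  -- formal power series: ordinary coefficient sequences  f(t) = Σ f n t^n
  PS : Set c
  PS = ℕ → Carrier

  constPS : Carrier → PS
  constPS a zero    = a
  constPS a (suc n) = 0#

  _⊕_ : PS → PS → PS
  (f ⊕ g) n = f n + g n

  scale : Carrier → PS → PS
  scale a f n = a * f n

  _⊛_ : PS → PS → PS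
  (f ⊛ g) n = sumTo n (λ k → f k * g (n ∸ k))

  powPS : PS → ℕ → PS
  powPS f zero    = constPS 1#
  powPS f (suc r) = powPS f r ⊛ f

  -- composition f(g(t)), meaningful when g 0 = 0
  compPS : PS → PS → PS
  compPS f g n = sumTo n (λ m → f m * powPS g m n)

  -- multiplicative inverse 1/f of a series with invertible constant term a = f 0:
  -- 1/f = a⁻¹ Σ_{k≥0} (1 - a⁻¹ f)^k   (the k-th term has order ≥ k)
  recipPS : PS → PS
  recipPS f n = f 0 ⁻¹ * sumTo n (λ k → powPS (constPS 1# ⊕ scale (- (f 0 ⁻¹)) f) k n)

  dfall : Carrier → Carrier → ℕ → Carrier
  dfall x lam zero    = 1#
  dfall x lam (suc n) = dfall x lam n * (x - ι n * lam)

  -- (1 + λ u)^{x/λ} = Σ_m (x)_{m,λ} u^m / m!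
  degPow : Carrier → Carrier → PS
  degPow lam x m = dfall x lam m * (fact m ⁻¹)

  log1p : PS
  log1p zero    = 0#
  log1p (suc n) = sgn n * (ι (suc n) ⁻¹)
    where
    sgn : ℕ → Carrier
    sgn zero    = 1#
    sgn (suc k) = - sgn k

  -- generating function of Carlitz's degenerate Euler polynomials of order r:
  -- (2 / ((1+λt)^{1/λ} + 1))^r (1+λt)^{x/λ}
  carlitzGF : ℕ → Carrier → Carrier → PS
  carlitzGF r lam x =
    powPS (scale two (recipPS (degPow lam 1# ⊕ constPS 1#))) r ⊛ degPow lam x

  degEuler : ℕ → Carrier → ℕ → Carrier → Carrier
  degEuler r lam n x = fact n * carlitzGF r lam x n

  -- generating function of the higher-order degenerate Changhee polynomials of the
  -- second kind: (2 / (1 + (1+λ log(1+t))^{1/λ}))^r (1+λ log(1+t))^{x/λ}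
  changheeGF : ℕ → Carrier → Carrier → PS
  changheeGF r lam x =
    powPS (scale two (recipPS (constPS 1# ⊕ compPS (degPow lam 1#) log1p))) r
      ⊛ compPS (degPow lam x) log1p

  changhee : ℕ → Carrier → ℕ → Carrier → Carrier
  changhee r lam n x = fact n * changheeGF r lam x n

S₂ : ℕ → ℕ → ℕ
S₂ zero    zero    = 1
S₂ zero    (suc m) = 0
S₂ (suc n) zero    = 0
S₂ (suc n) (suc m) = suc m ℕ.* S₂ n (suc m) ℕ.+ S₂ n m

module Submission where

-- Write G_E(t) and G_Ch(t) for the two generating functions (Defs).
-- The Changhee series is obtained from the Carlitz series by the substitution
-- t ↦ log(1+t), i.e. G_Ch = G_E ∘ log(1+t).  Since log(1+t) ∘ (eᵗ − 1) = t,
-- substituting eᵗ − 1 back gives G_E = G_Ch ∘ (eᵗ − 1), and the coefficients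
-- n![tⁿ](eᵗ − 1)ᵐ = m! S₂(n,m) turn this into the claimed identity.
--
-- Everything happens in the ring of formal power series over a field of
-- characteristic zero, series being coefficient sequences ℕ → F.  The basic
-- tool is the formal derivative ∂ together with a uniqueness principle: two
-- series with equal constant terms whose derivatives agree are equal (this is
-- where characteristic zero is used).

open import Defs
open import Level using (Level)
open import Data.Nat as ℕ using (ℕ; zero; suc; _∸_; _≤_; _<_; z≤n; s≤s)
import Data.Nat.Properties as ℕₚ
open import Data.Product using (_×_; _,_; Σ-syntax)
open import Data.Sum using (inj₁; inj₂)
open import Data.Unit using (⊤; tt)
open import Relation.Nullary using (¬_; yes; no)
open import Relation.Binary.PropositionalEquality as ≡ using (_≡_)
open import Algebra using (CommutativeSemiring)
import Algebra.Solver.Ring.NaturalCoefficients.Default as NatCoeffSolver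
import Algebra.Properties.CommutativeSemigroup as CommSemigroupProperties
import Algebra.Properties.Ring as RingProperties
import Relation.Binary.Reasoning.Setoid as SetoidReasoning

module FormalPowerSeries {c ℓ : Level} (F : CharZeroField c ℓ) where
  open CharZeroField F
  open SetoidReasoning setoid
  open CommSemigroupProperties +-commutativeSemigroup using ()
    renaming (interchange to +-interchange; xy∙z≈xz∙y to +-swapʳ)
  open CommSemigroupProperties *-commutativeSemigroup using ()
    renaming (x∙yz≈y∙xz to *-rotate; x∙yz≈yx∙z to *-rotate-assoc)
  open RingProperties ring using (-‿distribˡ-*)

  ι-+ : ∀ m n → ι F (m ℕ.+ n) ≈ ι F m + ι F n
  ι-+ zero    n = sym (+-identityˡ _)
  ι-+ (suc m) n = trans (+-cong (ι-+ m n) refl) (+-swapʳ _ _ _)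

  ι-* : ∀ m n → ι F (m ℕ.* n) ≈ ι F m * ι F n
  ι-* zero    n = sym (zeroˡ _)
  ι-* (suc m) n = begin
    ι F (n ℕ.+ m ℕ.* n)          ≈⟨ ι-+ n (m ℕ.* n) ⟩
    ι F n + ι F (m ℕ.* n)        ≈⟨ +-cong refl (ι-* m n) ⟩
    ι F n + ι F m * ι F n        ≈⟨ +-comm _ _ ⟩
    ι F m * ι F n + ι F n        ≈⟨ +-cong refl (*-identityˡ _) ⟨
    ι F m * ι F n + 1# * ι F n   ≈⟨ distribʳ _ _ _ ⟨
    (ι F m + 1#) * ι F n         ∎

  ι-one : ι F 1 ≈ 1#
  ι-one = +-identityˡ 1#

  ∑ : ℕ → (ℕ → Carrier) → Carrier
  ∑ = sumTo F

  ∑-cong : ∀ n {f g : ℕ → Carrier} → (∀ k → f k ≈ g k) → ∑ n f ≈ ∑ n g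
  ∑-cong zero    p = p 0
  ∑-cong (suc n) p = +-cong (∑-cong n p) (p (suc n))

  ∑-cong≤ : ∀ n {f g : ℕ → Carrier} → (∀ k → k ≤ n → f k ≈ g k) → ∑ n f ≈ ∑ n g
  ∑-cong≤ zero    p = p 0 z≤n
  ∑-cong≤ (suc n) p =
    +-cong (∑-cong≤ n (λ k k≤n → p k (ℕₚ.m≤n⇒m≤1+n k≤n))) (p (suc n) ℕₚ.≤-refl)

  ∑-+ : ∀ n (f g : ℕ → Carrier) → ∑ n (λ k → f k + g k) ≈ ∑ n f + ∑ n g
  ∑-+ zero    f g = refl
  ∑-+ (suc n) f g = trans (+-cong (∑-+ n f g) refl) (+-interchange _ _ _ _)

  ∑-*ˡ : ∀ n a (f : ℕ → Carrier) → a * ∑ n f ≈ ∑ n (λ k → a * f k)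
  ∑-*ˡ zero    a f = refl
  ∑-*ˡ (suc n) a f = trans (distribˡ _ _ _) (+-cong (∑-*ˡ n a f) refl)

  ∑-*ʳ : ∀ n a (f : ℕ → Carrier) → ∑ n f * a ≈ ∑ n (λ k → f k * a)
  ∑-*ʳ zero    a f = refl
  ∑-*ʳ (suc n) a f = trans (distribʳ _ _ _) (+-cong (∑-*ʳ n a f) refl)

  ∑-zero : ∀ n (f : ℕ → Carrier) → (∀ k → k ≤ n → f k ≈ 0#) → ∑ n f ≈ 0#
  ∑-zero n f p = trans (∑-cong≤ n p) (zeros n)
    where
    zeros : ∀ n → ∑ n (λ _ → 0#) ≈ 0#
    zeros zero    = refl
    zeros (suc n) = trans (+-identityʳ _) (zeros n)

  ∑-head : ∀ n (f : ℕ → Carrier) → ∑ (suc n) f ≈ f 0 + ∑ n (λ k → f (suc k))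
  ∑-head zero    f = refl
  ∑-head (suc n) f = trans (+-cong (∑-head n f) refl) (+-assoc _ _ _)

  ∑-swap : ∀ n m (f : ℕ → ℕ → Carrier) →
           ∑ n (λ i → ∑ m (λ j → f i j)) ≈ ∑ m (λ j → ∑ n (λ i → f i j))
  ∑-swap zero    m f = refl
  ∑-swap (suc n) m f = trans (+-cong (∑-swap n m f) refl) (sym (∑-+ m _ _))

  ∑-truncate : ∀ {n} N (f : ℕ → Carrier) → n ≤ N →
               (∀ k → n < k → k ≤ N → f k ≈ 0#) → ∑ N f ≈ ∑ n f
  ∑-truncate zero f z≤n _ = refl
  ∑-truncate (suc N) f n≤1+N vanish with ℕₚ.m≤n⇒m<n∨m≡n n≤1+N
  ... | inj₁ n<1+N = trans
        (+-cong (∑-truncate N f (ℕₚ.≤-pred n<1+N)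
                   (λ k n<k k≤N → vanish k n<k (ℕₚ.m≤n⇒m≤1+n k≤N)))
                (vanish (suc N) n<1+N ℕₚ.≤-refl))
        (+-identityʳ _)
  ... | inj₂ ≡.refl = refl

  inverse-unique : ∀ a b → ¬ (a ≈ 0#) → a * b ≈ 1# → b ≈ a ⁻¹
  inverse-unique a b a≉0 ab≈1 = begin
    b                ≈⟨ *-identityʳ b ⟨
    b * 1#           ≈⟨ *-cong refl (⁻¹-inverse a a≉0) ⟨
    b * (a * a ⁻¹)   ≈⟨ *-rotate-assoc b a (a ⁻¹) ⟩
    (a * b) * a ⁻¹   ≈⟨ *-cong ab≈1 refl ⟩
    1# * a ⁻¹        ≈⟨ *-identityˡ _ ⟩
    a ⁻¹             ∎

  inverse-cong : ∀ {a b} → a ≈ b → ¬ (a ≈ 0#) → a ⁻¹ ≈ b ⁻¹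
  inverse-cong a≈b a≉0 = inverse-unique _ _ (λ b≈0 → a≉0 (trans a≈b b≈0))
    (trans (*-cong (sym a≈b) refl) (⁻¹-inverse _ a≉0))

  inverse-one : 1# ⁻¹ ≈ 1#
  inverse-one = sym (inverse-unique 1# 1# (λ 1≈0 → char-zero 0 (trans ι-one 1≈0))
                                          (*-identityˡ _))

  *-cancelˡ : ∀ {a b d} → ¬ (a ≈ 0#) → a * b ≈ a * d → b ≈ d
  *-cancelˡ {a} {b} {d} a≉0 ab≈ad = begin
    b                ≈⟨ *-identityˡ b ⟨
    1# * b           ≈⟨ *-cong (trans (*-comm _ _) (⁻¹-inverse a a≉0)) refl ⟨
    (a ⁻¹ * a) * b   ≈⟨ *-assoc _ _ _ ⟩
    a ⁻¹ * (a * b)   ≈⟨ *-cong refl ab≈ad ⟩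
    a ⁻¹ * (a * d)   ≈⟨ *-assoc _ _ _ ⟨
    (a ⁻¹ * a) * d   ≈⟨ *-cong (trans (*-comm _ _) (⁻¹-inverse a a≉0)) refl ⟩
    1# * d           ≈⟨ *-identityˡ d ⟩
    d                ∎

  *-nonzero : ∀ {a b} → ¬ (a ≈ 0#) → ¬ (b ≈ 0#) → ¬ (a * b ≈ 0#)
  *-nonzero {a} {b} a≉0 b≉0 ab≈0 =
    b≉0 (*-cancelˡ a≉0 (trans ab≈0 (sym (zeroʳ a))))

  fact-nonzero : ∀ n → ¬ (fact F n ≈ 0#)
  fact-nonzero zero    1≈0 = char-zero 0 (trans ι-one 1≈0)
  fact-nonzero (suc n) = *-nonzero (fact-nonzero n) (char-zero n)

  two-nonzero : ¬ (two F ≈ 0#)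
  two-nonzero 2≈0 = char-zero 1 (trans (+-cong ι-one refl) 2≈0)

  Series : Set c
  Series = PS F

  infix  4 _≋_ _≈[_]_
  infixl 6 _+ₛ_
  infixl 7 _*ₛ_ _·ₛ_
  infixl 8 _^ₛ_
  infixr 9 _∘ₛ_

  _+ₛ_ _*ₛ_ _∘ₛ_ : Series → Series → Series
  _+ₛ_ = _⊕_ F
  _*ₛ_ = _⊛_ F
  f ∘ₛ h = compPS F f h

  _·ₛ_ : Carrier → Series → Series
  _·ₛ_ = scale F

  _^ₛ_ : Series → ℕ → Series
  _^ₛ_ = powPS F

  constₛ : Carrier → Series
  constₛ = constPS F

  0ₛ 1ₛ : Series
  0ₛ _ = 0#
  1ₛ   = constₛ 1#

  X : Series
  X zero          = 0#
  X (suc zero)    = 1#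
  X (suc (suc _)) = 0#

  _≋_ : Series → Series → Set ℓ
  f ≋ g = ∀ n → f n ≈ g n

  _≈[_]_ : Series → ℕ → Series → Set ℓ
  f ≈[ n ] g = ∀ k → k ≤ n → f k ≈ g k

  ≋-refl : ∀ {f} → f ≋ f
  ≋-refl n = refl

  ≋-sym : ∀ {f g} → f ≋ g → g ≋ f
  ≋-sym p n = sym (p n)

  ≋-trans : ∀ {f g h} → f ≋ g → g ≋ h → f ≋ h
  ≋-trans p q n = trans (p n) (q n)

  +ₛ-cong : ∀ {f f' g g'} → f ≋ f' → g ≋ g' → f +ₛ g ≋ f' +ₛ g'
  +ₛ-cong p q n = +-cong (p n) (q n)

  ·ₛ-cong : ∀ {a b f g} → a ≈ b → f ≋ g → a ·ₛ f ≋ b ·ₛ g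
  ·ₛ-cong p q n = *-cong p (q n)

  *ₛ-cong : ∀ {f f' g g'} → f ≋ f' → g ≋ g' → f *ₛ g ≋ f' *ₛ g'
  *ₛ-cong p q n = ∑-cong n (λ k → *-cong (p k) (q (n ∸ k)))

  *ₛ-congˡ : ∀ f {g g'} → g ≋ g' → f *ₛ g ≋ f *ₛ g'
  *ₛ-congˡ f = *ₛ-cong (≋-refl {f})

  *ₛ-congʳ : ∀ h {f f'} → f ≋ f' → f *ₛ h ≋ f' *ₛ h
  *ₛ-congʳ h p = *ₛ-cong p (≋-refl {h})

  *ₛ-congʳ≤ : ∀ {n f f'} g → f ≈[ n ] f' → f *ₛ g ≈[ n ] f' *ₛ g
  *ₛ-congʳ≤ g p k k≤n = ∑-cong≤ k (λ j j≤k → *-cong (p j (ℕₚ.≤-trans j≤k k≤n)) refl)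

  ^ₛ-cong : ∀ {f g} → f ≋ g → ∀ m → f ^ₛ m ≋ g ^ₛ m
  ^ₛ-cong p zero    = ≋-refl
  ^ₛ-cong p (suc m) = *ₛ-cong (^ₛ-cong p m) p

  ∘ₛ-congˡ : ∀ {f f'} h → f ≋ f' → f ∘ₛ h ≋ f' ∘ₛ h
  ∘ₛ-congˡ h p n = ∑-cong n (λ m → *-cong (p m) refl)

  ∘ₛ-congʳ : ∀ f {h h'} → h ≋ h' → f ∘ₛ h ≋ f ∘ₛ h'
  ∘ₛ-congʳ f p n = ∑-cong n (λ m → *-cong refl (^ₛ-cong p m n))

  *ₛ-distribˡ : ∀ f g h → f *ₛ (g +ₛ h) ≋ f *ₛ g +ₛ f *ₛ h
  *ₛ-distribˡ f g h n = trans (∑-cong n (λ k → distribˡ _ _ _)) (∑-+ n _ _)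

  *ₛ-distribʳ : ∀ f g h → (g +ₛ h) *ₛ f ≋ g *ₛ f +ₛ h *ₛ f
  *ₛ-distribʳ f g h n = trans (∑-cong n (λ k → distribʳ _ _ _)) (∑-+ n _ _)

  *ₛ-·ₛˡ : ∀ a f g → (a ·ₛ f) *ₛ g ≋ a ·ₛ (f *ₛ g)
  *ₛ-·ₛˡ a f g n = trans (∑-cong n (λ k → *-assoc _ _ _)) (sym (∑-*ˡ n a _))

  *ₛ-zeroˡ : ∀ g → 0ₛ *ₛ g ≋ 0ₛ
  *ₛ-zeroˡ g n = ∑-zero n _ (λ k _ → zeroˡ _)

  *ₛ-identityˡ : ∀ f → 1ₛ *ₛ f ≋ f
  *ₛ-identityˡ f zero    = *-identityˡ _
  *ₛ-identityˡ f (suc n) = begin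
    ∑ (suc n) (λ k → 1ₛ k * f (suc n ∸ k))
      ≈⟨ ∑-head n _ ⟩
    1# * f (suc n) + ∑ n (λ k → 0# * f (n ∸ k))
      ≈⟨ +-cong (*-identityˡ _) (∑-zero n _ (λ k _ → zeroˡ _)) ⟩
    f (suc n) + 0#
      ≈⟨ +-identityʳ _ ⟩
    f (suc n) ∎

  X-*ₛ-shift : ∀ g n → (X *ₛ g) (suc n) ≈ g n
  X-*ₛ-shift g n = begin
    ∑ (suc n) (λ k → X k * g (suc n ∸ k))
      ≈⟨ ∑-head n _ ⟩
    0# * g (suc n) + ∑ n (λ k → X (suc k) * g (n ∸ k))
      ≈⟨ +-cong (zeroˡ _) (first-only n) ⟩
    0# + g n
      ≈⟨ +-identityˡ _ ⟩
    g n ∎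
    where
    first-only : ∀ n → ∑ n (λ k → X (suc k) * g (n ∸ k)) ≈ g n
    first-only zero    = *-identityˡ _
    first-only (suc n) = begin
      ∑ (suc n) (λ k → X (suc k) * g (suc n ∸ k))
        ≈⟨ ∑-head n _ ⟩
      1# * g (suc n) + ∑ n (λ k → 0# * g (n ∸ k))
        ≈⟨ +-cong (*-identityˡ _) (∑-zero n _ (λ k _ → zeroˡ _)) ⟩
      g (suc n) + 0#
        ≈⟨ +-identityʳ _ ⟩
      g (suc n) ∎

  -- The formal derivative and the uniqueness principle

  ∂ : Series → Series
  ∂ f n = ι F (suc n) * f (suc n)

  ∂-const : ∀ a → ∂ (constₛ a) ≋ 0ₛ
  ∂-const a n = zeroʳ _

  -- Leibniz rule: the coefficient ι(n+1) of tⁿ⁺¹ splits as ι k + ι (n+1-k)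
  ∂-*ₛ : ∀ f g → ∂ (f *ₛ g) ≋ ∂ f *ₛ g +ₛ f *ₛ ∂ g
  ∂-*ₛ f g n = begin
    ι F (suc n) * ∑ (suc n) (λ k → f k * g (suc n ∸ k))
      ≈⟨ ∑-*ˡ (suc n) _ _ ⟩
    ∑ (suc n) (λ k → ι F (suc n) * (f k * g (suc n ∸ k)))
      ≈⟨ ∑-cong≤ (suc n) split ⟩
    ∑ (suc n) (λ k → left k + right k)
      ≈⟨ ∑-+ (suc n) left right ⟩
    ∑ (suc n) left + ∑ (suc n) right
      ≈⟨ +-cong left-sum right-sum ⟩
    (∂ f *ₛ g) n + (f *ₛ ∂ g) n ∎
    where
    left right : ℕ → Carrier
    left  k = ι F k * (f k * g (suc n ∸ k))
    right k = ι F (suc n ∸ k) * (f k * g (suc n ∸ k))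

    split : ∀ k → k ≤ suc n → ι F (suc n) * (f k * g (suc n ∸ k)) ≈ left k + right k
    split k k≤ = trans (*-cong ι-split refl) (distribʳ _ _ _)
      where
      ι-split : ι F (suc n) ≈ ι F k + ι F (suc n ∸ k)
      ι-split = trans (reflexive (≡.cong (ι F) (≡.sym (ℕₚ.m+[n∸m]≡n k≤))))
                      (ι-+ k (suc n ∸ k))

    left-sum : ∑ (suc n) left ≈ (∂ f *ₛ g) n
    left-sum = begin
      ∑ (suc n) left                                  ≈⟨ ∑-head n left ⟩
      0# * _ + ∑ n (λ k → left (suc k))               ≈⟨ +-cong (zeroˡ _) refl ⟩
      0# + ∑ n (λ k → left (suc k))                   ≈⟨ +-identityˡ _ ⟩
      ∑ n (λ k → left (suc k))                        ≈⟨ ∑-cong n (λ k → *-assoc _ _ _) ⟨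
      (∂ f *ₛ g) n                                    ∎

    -- for k ≤ n the index n+1-k is the successor of n-k
    right-term : ∀ k s → s ≡ suc (n ∸ k) →
                 ι F s * (f k * g s) ≈ f k * (ι F (suc (n ∸ k)) * g (suc (n ∸ k)))
    right-term k s ≡.refl = *-rotate _ _ _

    right-sum : ∑ (suc n) right ≈ (f *ₛ ∂ g) n
    right-sum = trans
      (+-cong (∑-cong≤ n (λ k k≤n → right-term k (suc n ∸ k) (ℕₚ.+-∸-assoc 1 k≤n)))
              (trans (*-cong (reflexive (≡.cong (ι F) (ℕₚ.n∸n≡0 (suc n)))) refl) (zeroˡ _)))
      (+-identityʳ _)

  -- Uniqueness principle: if two families of series have the same constant
  -- terms, and agreement of all members up to degree n forces their
  -- derivatives to agree in degree n, then the families are equal.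
  -- (Coefficient n+1 is recovered from ∂ by cancelling ι(n+1) ≠ 0.)
  ≋-by-derivative : ∀ {a} {I : Set a} (A B : I → Series) →
    (∀ i → A i 0 ≈ B i 0) →
    (∀ n → (∀ i → A i ≈[ n ] B i) → ∀ i → ∂ (A i) n ≈ ∂ (B i) n) →
    ∀ i → A i ≋ B i
  ≋-by-derivative A B base step i n = agree n i n ℕₚ.≤-refl
    where
    agree : ∀ n i → A i ≈[ n ] B i
    agree zero    i zero z≤n = base i
    agree (suc n) i k k≤1+n with ℕₚ.m≤n⇒m<n∨m≡n k≤1+n
    ... | inj₁ k<1+n  = agree n i k (ℕₚ.≤-pred k<1+n)
    ... | inj₂ ≡.refl = *-cancelˡ (char-zero n) (step n (agree n) i)

  ≋-by-derivative₁ : ∀ {f g} → f 0 ≈ g 0 → (∀ n → f ≈[ n ] g → ∂ f n ≈ ∂ g n) → f ≋ g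
  ≋-by-derivative₁ {f} {g} base step =
    ≋-by-derivative {I = ⊤} (λ _ → f) (λ _ → g) (λ _ → base)
                    (λ n agree _ → step n (agree tt)) tt

  -- Series form a commutative semiring

  *ₛ-comm : ∀ f g → f *ₛ g ≋ g *ₛ f
  *ₛ-comm f g = ≋-by-derivative lhs rhs (λ _ → *-comm _ _) step (f , g)
    where
    lhs rhs : Series × Series → Series
    lhs (f , g) = f *ₛ g
    rhs (f , g) = g *ₛ f
    step : ∀ n → (∀ p → lhs p ≈[ n ] rhs p) → ∀ p → ∂ (lhs p) n ≈ ∂ (rhs p) n
    step n ih (f , g) = begin
      ∂ (f *ₛ g) n                   ≈⟨ ∂-*ₛ f g n ⟩
      (∂ f *ₛ g) n + (f *ₛ ∂ g) n    ≈⟨ +-cong (ih (∂ f , g) n ℕₚ.≤-refl) (ih (f , ∂ g) n ℕₚ.≤-refl) ⟩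
      (g *ₛ ∂ f) n + (∂ g *ₛ f) n    ≈⟨ +-comm _ _ ⟩
      (∂ g *ₛ f) n + (g *ₛ ∂ f) n    ≈⟨ ∂-*ₛ g f n ⟨
      ∂ (g *ₛ f) n                   ∎

  *ₛ-assoc : ∀ f g h → (f *ₛ g) *ₛ h ≋ f *ₛ (g *ₛ h)
  *ₛ-assoc f g h = ≋-by-derivative lhs rhs (λ _ → *-assoc _ _ _) step (f , g , h)
    where
    lhs rhs : Series × Series × Series → Series
    lhs (f , g , h) = (f *ₛ g) *ₛ h
    rhs (f , g , h) = f *ₛ (g *ₛ h)
    step : ∀ n → (∀ p → lhs p ≈[ n ] rhs p) → ∀ p → ∂ (lhs p) n ≈ ∂ (rhs p) n
    step n ih (f , g , h) = begin
      ∂ ((f *ₛ g) *ₛ h) n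
        ≈⟨ ∂-*ₛ (f *ₛ g) h n ⟩
      (∂ (f *ₛ g) *ₛ h) n + ((f *ₛ g) *ₛ ∂ h) n
        ≈⟨ +-cong (trans (*ₛ-congʳ h (∂-*ₛ f g) n) (*ₛ-distribʳ h _ _ n)) refl ⟩
      ((∂ f *ₛ g) *ₛ h) n + ((f *ₛ ∂ g) *ₛ h) n + ((f *ₛ g) *ₛ ∂ h) n
        ≈⟨ +-cong (+-cong (ih (∂ f , g , h) n ℕₚ.≤-refl) (ih (f , ∂ g , h) n ℕₚ.≤-refl))
                  (ih (f , g , ∂ h) n ℕₚ.≤-refl) ⟩
      (∂ f *ₛ (g *ₛ h)) n + (f *ₛ (∂ g *ₛ h)) n + (f *ₛ (g *ₛ ∂ h)) n
        ≈⟨ +-assoc _ _ _ ⟩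
      (∂ f *ₛ (g *ₛ h)) n + ((f *ₛ (∂ g *ₛ h)) n + (f *ₛ (g *ₛ ∂ h)) n)
        ≈⟨ +-cong refl (trans (*ₛ-congˡ f (∂-*ₛ g h) n) (*ₛ-distribˡ f (∂ g *ₛ h) (g *ₛ ∂ h) n)) ⟨
      (∂ f *ₛ (g *ₛ h)) n + (f *ₛ ∂ (g *ₛ h)) n
        ≈⟨ ∂-*ₛ f (g *ₛ h) n ⟨
      ∂ (f *ₛ (g *ₛ h)) n ∎

  -- packaged so that the ring solver can normalise series expressions
  seriesSemiring : CommutativeSemiring c ℓ
  seriesSemiring = record
    { Carrier = Series ; _≈_ = _≋_ ; _+_ = _+ₛ_ ; _*_ = _*ₛ_ ; 0# = 0ₛ ; 1# = 1ₛ
    ; isCommutativeSemiring = record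
      { isSemiring = record
        { isSemiringWithoutAnnihilatingZero = record
          { +-isCommutativeMonoid = record
            { isMonoid = record
              { isSemigroup = record
                { isMagma = record
                  { isEquivalence = record { refl = ≋-refl ; sym = ≋-sym ; trans = ≋-trans }
                  ; ∙-cong = +ₛ-cong }
                ; assoc = λ f g h n → +-assoc _ _ _ }
              ; identity = (λ f n → +-identityˡ _) , (λ f n → +-identityʳ _) }
            ; comm = λ f g n → +-comm _ _ }
          ; *-cong = *ₛ-cong
          ; *-assoc = *ₛ-assoc
          ; *-identity = *ₛ-identityˡ , (λ f → ≋-trans (*ₛ-comm f 1ₛ) (*ₛ-identityˡ f))
          ; distrib = *ₛ-distribˡ , *ₛ-distribʳ }
        ; zero = *ₛ-zeroˡ , (λ g → ≋-trans (*ₛ-comm g 0ₛ) (*ₛ-zeroˡ g)) }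
      ; *-comm = *ₛ-comm } }

  open CommutativeSemiring seriesSemiring using ()
    renaming (*-identityʳ to *ₛ-identityʳ)
  open CommSemigroupProperties (CommutativeSemiring.*-commutativeSemigroup seriesSemiring)
    using () renaming (xy∙z≈xz∙y to *ₛ-swapʳ)
  private module SeriesSolver = NatCoeffSolver seriesSemiring
  private module ScalarSolver = NatCoeffSolver commutativeSemiring

  ∂-^ₛ : ∀ h m → ∂ (h ^ₛ suc m) ≋ ι F (suc m) ·ₛ (h ^ₛ m *ₛ ∂ h)
  ∂-^ₛ h zero n = begin
    ∂ (1ₛ *ₛ h) n                       ≈⟨ ∂-*ₛ 1ₛ h n ⟩
    (∂ 1ₛ *ₛ h) n + (1ₛ *ₛ ∂ h) n       ≈⟨ +-cong (trans (*ₛ-congʳ h (∂-const 1#) n) (*ₛ-zeroˡ h n)) refl ⟩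
    0# + (1ₛ *ₛ ∂ h) n                  ≈⟨ +-identityˡ _ ⟩
    (1ₛ *ₛ ∂ h) n                       ≈⟨ trans (*-cong ι-one refl) (*-identityˡ _) ⟨
    ι F 1 * (1ₛ *ₛ ∂ h) n               ∎
  ∂-^ₛ h (suc m) n = begin
    ∂ (h ^ₛ suc m *ₛ h) n
      ≈⟨ ∂-*ₛ (h ^ₛ suc m) h n ⟩
    (∂ (h ^ₛ suc m) *ₛ h) n + Y n
      ≈⟨ +-cong (trans (*ₛ-congʳ h (∂-^ₛ h m) n) (*ₛ-·ₛˡ i (h ^ₛ m *ₛ ∂ h) h n)) refl ⟩
    i * ((h ^ₛ m *ₛ ∂ h) *ₛ h) n + Y n
      ≈⟨ +-cong (*-cong refl (*ₛ-swapʳ (h ^ₛ m) (∂ h) h n)) (sym (*-identityˡ _)) ⟩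
    i * Y n + 1# * Y n
      ≈⟨ distribʳ _ _ _ ⟨
    ι F (suc (suc m)) * Y n ∎
    where
    i = ι F (suc m)
    Y = h ^ₛ suc m *ₛ ∂ h

  ^ₛ-order : ∀ h → h 0 ≈ 0# → ∀ m k → k < m → (h ^ₛ m) k ≈ 0#
  ^ₛ-order h h₀≈0 (suc m) k (s≤s k≤m) = ∑-zero k _ term
    where
    term : ∀ j → j ≤ k → (h ^ₛ m) j * h (k ∸ j) ≈ 0#
    term j j≤k with j ℕₚ.<? m
    ... | yes j<m = trans (*-cong (^ₛ-order h h₀≈0 m j j<m) refl) (zeroˡ _)
    ... | no  j≮m = trans (*-cong refl h[k-j]≈0) (zeroʳ _)
      where
      h[k-j]≈0 : h (k ∸ j) ≈ 0#
      h[k-j]≈0 = trans (reflexive (≡.cong h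
                   (ℕₚ.m≤n⇒m∸n≡0 (ℕₚ.≤-trans k≤m (ℕₚ.≮⇒≥ j≮m))))) h₀≈0

  -- Substitution

  ∘ₛ-constant : ∀ f h → (f ∘ₛ h) 0 ≈ f 0
  ∘ₛ-constant f h = *-identityʳ _

  ∘ₛ-+ₛ : ∀ f g h → (f +ₛ g) ∘ₛ h ≋ f ∘ₛ h +ₛ g ∘ₛ h
  ∘ₛ-+ₛ f g h n = trans (∑-cong n (λ m → distribʳ _ _ _)) (∑-+ n _ _)

  ∘ₛ-·ₛ : ∀ a f h → (a ·ₛ f) ∘ₛ h ≋ a ·ₛ (f ∘ₛ h)
  ∘ₛ-·ₛ a f h n = trans (∑-cong n (λ m → *-assoc _ _ _)) (sym (∑-*ˡ n a _))

  ∘ₛ-const : ∀ a h → constₛ a ∘ₛ h ≋ constₛ a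
  ∘ₛ-const a h zero    = *-identityʳ _
  ∘ₛ-const a h (suc n) = trans (∑-head n _)
    (trans (+-cong (zeroʳ _) (∑-zero n _ (λ k _ → zeroˡ _))) (+-identityˡ _))

  -- chain rule  ∂(f ∘ h) = (∂f ∘ h) · ∂h, for h without constant term;
  -- the truncation of f ∘ h at degree k only involves hᵐ with m ≤ k
  ∂-∘ₛ : ∀ f h → h 0 ≈ 0# → ∂ (f ∘ₛ h) ≋ (∂ f ∘ₛ h) *ₛ ∂ h
  ∂-∘ₛ f h h₀≈0 n = begin
    ι F (suc n) * ∑ (suc n) (λ m → f m * (h ^ₛ m) (suc n))
      ≈⟨ ∑-*ˡ (suc n) _ _ ⟩
    ∑ (suc n) (λ m → ι F (suc n) * (f m * (h ^ₛ m) (suc n)))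
      ≈⟨ ∑-cong (suc n) (λ m → *-rotate _ _ _) ⟩
    ∑ (suc n) (λ m → f m * ∂ (h ^ₛ m) n)
      ≈⟨ ∑-head n _ ⟩
    f 0 * ∂ 1ₛ n + ∑ n (λ m → f (suc m) * ∂ (h ^ₛ suc m) n)
      ≈⟨ +-cong (trans (*-cong refl (∂-const 1# n)) (zeroʳ _))
                (∑-cong n (λ m → trans (*-cong refl (∂-^ₛ h m n)) (*-rotate-assoc _ _ _))) ⟩
    0# + ∑ n (λ m → ∂ f m * (h ^ₛ m *ₛ ∂ h) n)
      ≈⟨ +-identityˡ _ ⟩
    ∑ n (λ m → ∂ f m * ∑ n (λ k → (h ^ₛ m) k * ∂ h (n ∸ k)))
      ≈⟨ ∑-cong n (λ m → ∑-*ˡ n _ _) ⟩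
    ∑ n (λ m → ∑ n (λ k → ∂ f m * ((h ^ₛ m) k * ∂ h (n ∸ k))))
      ≈⟨ ∑-swap n n _ ⟩
    ∑ n (λ k → ∑ n (λ m → ∂ f m * ((h ^ₛ m) k * ∂ h (n ∸ k))))
      ≈⟨ ∑-cong≤ n inner ⟩
    ((∂ f ∘ₛ h) *ₛ ∂ h) n ∎
    where
    inner : ∀ k → k ≤ n →
            ∑ n (λ m → ∂ f m * ((h ^ₛ m) k * ∂ h (n ∸ k))) ≈ (∂ f ∘ₛ h) k * ∂ h (n ∸ k)
    inner k k≤n = begin
      ∑ n (λ m → ∂ f m * ((h ^ₛ m) k * ∂ h (n ∸ k)))
        ≈⟨ ∑-cong n (λ m → *-assoc _ _ _) ⟨
      ∑ n (λ m → (∂ f m * (h ^ₛ m) k) * ∂ h (n ∸ k))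
        ≈⟨ ∑-*ʳ n _ _ ⟨
      ∑ n (λ m → ∂ f m * (h ^ₛ m) k) * ∂ h (n ∸ k)
        ≈⟨ *-cong (∑-truncate n _ k≤n (λ m k<m _ →
                     trans (*-cong refl (^ₛ-order h h₀≈0 m k k<m)) (zeroʳ _))) refl ⟩
      (∂ f ∘ₛ h) k * ∂ h (n ∸ k) ∎

  ∘ₛ-*ₛ : ∀ f g h → h 0 ≈ 0# → (f *ₛ g) ∘ₛ h ≋ (f ∘ₛ h) *ₛ (g ∘ₛ h)
  ∘ₛ-*ₛ f g h h₀≈0 = ≋-by-derivative lhs rhs base step (f , g)
    where
    lhs rhs : Series × Series → Series
    lhs (f , g) = (f *ₛ g) ∘ₛ h
    rhs (f , g) = (f ∘ₛ h) *ₛ (g ∘ₛ h)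
    base : ∀ p → lhs p 0 ≈ rhs p 0
    base (f , g) = trans (*-identityʳ _) (sym (*-cong (*-identityʳ _) (*-identityʳ _)))
    rearrange : ∀ a b d e g → (a *ₛ b +ₛ d *ₛ e) *ₛ g ≋ (a *ₛ g) *ₛ b +ₛ d *ₛ (e *ₛ g)
    rearrange = SeriesSolver.solve 5 (λ a b d e g →
      (a :* b :+ d :* e) :* g := (a :* g) :* b :+ d :* (e :* g)) ≋-refl
      where open SeriesSolver
    step : ∀ n → (∀ p → lhs p ≈[ n ] rhs p) → ∀ p → ∂ (lhs p) n ≈ ∂ (rhs p) n
    step n ih (f , g) = begin
      ∂ ((f *ₛ g) ∘ₛ h) n
        ≈⟨ ∂-∘ₛ (f *ₛ g) h h₀≈0 n ⟩
      ((∂ (f *ₛ g) ∘ₛ h) *ₛ ∂ h) n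
        ≈⟨ *ₛ-congʳ (∂ h) (≋-trans (∘ₛ-congˡ h (∂-*ₛ f g)) (∘ₛ-+ₛ (∂ f *ₛ g) (f *ₛ ∂ g) h)) n ⟩
      (((∂ f *ₛ g) ∘ₛ h +ₛ (f *ₛ ∂ g) ∘ₛ h) *ₛ ∂ h) n
        ≈⟨ *ₛ-congʳ≤ (∂ h) (λ k k≤n → +-cong (ih (∂ f , g) k k≤n) (ih (f , ∂ g) k k≤n)) n ℕₚ.≤-refl ⟩
      (((∂ f ∘ₛ h) *ₛ (g ∘ₛ h) +ₛ (f ∘ₛ h) *ₛ (∂ g ∘ₛ h)) *ₛ ∂ h) n
        ≈⟨ rearrange (∂ f ∘ₛ h) (g ∘ₛ h) (f ∘ₛ h) (∂ g ∘ₛ h) (∂ h) n ⟩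
      (((∂ f ∘ₛ h) *ₛ ∂ h) *ₛ (g ∘ₛ h) +ₛ (f ∘ₛ h) *ₛ ((∂ g ∘ₛ h) *ₛ ∂ h)) n
        ≈⟨ +-cong (*ₛ-congʳ (g ∘ₛ h) (≋-sym (∂-∘ₛ f h h₀≈0)) n)
                  (*ₛ-congˡ (f ∘ₛ h) (≋-sym (∂-∘ₛ g h h₀≈0)) n) ⟩
      (∂ (f ∘ₛ h) *ₛ (g ∘ₛ h) +ₛ (f ∘ₛ h) *ₛ ∂ (g ∘ₛ h)) n
        ≈⟨ ∂-*ₛ (f ∘ₛ h) (g ∘ₛ h) n ⟨
      ∂ ((f ∘ₛ h) *ₛ (g ∘ₛ h)) n ∎

  ∘ₛ-^ₛ : ∀ f h → h 0 ≈ 0# → ∀ m → (f ^ₛ m) ∘ₛ h ≋ (f ∘ₛ h) ^ₛ m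
  ∘ₛ-^ₛ f h h₀≈0 zero    = ∘ₛ-const 1# h
  ∘ₛ-^ₛ f h h₀≈0 (suc m) =
    ≋-trans (∘ₛ-*ₛ (f ^ₛ m) f h h₀≈0) (*ₛ-congʳ (f ∘ₛ h) (∘ₛ-^ₛ f h h₀≈0 m))

  ∘ₛ-assoc : ∀ f g h → g 0 ≈ 0# → h 0 ≈ 0# → (f ∘ₛ g) ∘ₛ h ≋ f ∘ₛ (g ∘ₛ h)
  ∘ₛ-assoc f g h g₀≈0 h₀≈0 =
    ≋-by-derivative (λ f → (f ∘ₛ g) ∘ₛ h) (λ f → f ∘ₛ (g ∘ₛ h)) (λ f → *-identityʳ _) step f
    where
    [g∘h]₀≈0 : (g ∘ₛ h) 0 ≈ 0#
    [g∘h]₀≈0 = trans (∘ₛ-constant g h) g₀≈0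
    step : ∀ n → (∀ f → (f ∘ₛ g) ∘ₛ h ≈[ n ] f ∘ₛ (g ∘ₛ h)) →
           ∀ f → ∂ ((f ∘ₛ g) ∘ₛ h) n ≈ ∂ (f ∘ₛ (g ∘ₛ h)) n
    step n ih f = begin
      ∂ ((f ∘ₛ g) ∘ₛ h) n
        ≈⟨ ∂-∘ₛ (f ∘ₛ g) h h₀≈0 n ⟩
      ((∂ (f ∘ₛ g) ∘ₛ h) *ₛ ∂ h) n
        ≈⟨ *ₛ-congʳ (∂ h) (≋-trans (∘ₛ-congˡ h (∂-∘ₛ f g g₀≈0)) (∘ₛ-*ₛ (∂ f ∘ₛ g) (∂ g) h h₀≈0)) n ⟩
      ((((∂ f ∘ₛ g) ∘ₛ h) *ₛ (∂ g ∘ₛ h)) *ₛ ∂ h) n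
        ≈⟨ *ₛ-congʳ≤ (∂ h) (*ₛ-congʳ≤ (∂ g ∘ₛ h) (ih (∂ f))) n ℕₚ.≤-refl ⟩
      (((∂ f ∘ₛ (g ∘ₛ h)) *ₛ (∂ g ∘ₛ h)) *ₛ ∂ h) n
        ≈⟨ *ₛ-assoc (∂ f ∘ₛ (g ∘ₛ h)) (∂ g ∘ₛ h) (∂ h) n ⟩
      ((∂ f ∘ₛ (g ∘ₛ h)) *ₛ ((∂ g ∘ₛ h) *ₛ ∂ h)) n
        ≈⟨ *ₛ-congˡ (∂ f ∘ₛ (g ∘ₛ h)) (∂-∘ₛ g h h₀≈0) n ⟨
      ((∂ f ∘ₛ (g ∘ₛ h)) *ₛ ∂ (g ∘ₛ h)) n
        ≈⟨ ∂-∘ₛ f (g ∘ₛ h) [g∘h]₀≈0 n ⟨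
      ∂ (f ∘ₛ (g ∘ₛ h)) n ∎

  ∂X : ∂ X ≋ 1ₛ
  ∂X zero    = trans (*-identityʳ _) ι-one
  ∂X (suc n) = zeroʳ _

  ∘ₛ-X : ∀ f → f ∘ₛ X ≋ f
  ∘ₛ-X = ≋-by-derivative (λ f → f ∘ₛ X) (λ f → f) (λ f → *-identityʳ _) step
    where
    step : ∀ n → (∀ f → f ∘ₛ X ≈[ n ] f) → ∀ f → ∂ (f ∘ₛ X) n ≈ ∂ f n
    step n ih f = begin
      ∂ (f ∘ₛ X) n             ≈⟨ ∂-∘ₛ f X refl n ⟩
      ((∂ f ∘ₛ X) *ₛ ∂ X) n    ≈⟨ *ₛ-congˡ (∂ f ∘ₛ X) ∂X n ⟩
      ((∂ f ∘ₛ X) *ₛ 1ₛ) n     ≈⟨ *ₛ-identityʳ (∂ f ∘ₛ X) n ⟩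
      (∂ f ∘ₛ X) n             ≈⟨ ih (∂ f) n ℕₚ.≤-refl ⟩
      ∂ f n                    ∎

  X-∘ₛ : ∀ h → h 0 ≈ 0# → X ∘ₛ h ≋ h
  X-∘ₛ h h₀≈0 = ≋-by-derivative₁ (trans (zeroˡ _) (sym h₀≈0)) step
    where
    step : ∀ n → X ∘ₛ h ≈[ n ] h → ∂ (X ∘ₛ h) n ≈ ∂ h n
    step n _ = begin
      ∂ (X ∘ₛ h) n             ≈⟨ ∂-∘ₛ X h h₀≈0 n ⟩
      ((∂ X ∘ₛ h) *ₛ ∂ h) n    ≈⟨ *ₛ-congʳ (∂ h) (≋-trans (∘ₛ-congˡ h ∂X) (∘ₛ-const 1# h)) n ⟩
      (1ₛ *ₛ ∂ h) n            ≈⟨ *ₛ-identityˡ (∂ h) n ⟩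
      ∂ h n                    ∎

  -- Reciprocals commute with substitution

  -- recipPS f = f₀⁻¹ · (geometric ∘ (1 − f₀⁻¹ f)), with geometric = 1/(1−t)
  geometric : Series
  geometric _ = 1#

  recipBase : Series → Series
  recipBase f = 1ₛ +ₛ (- (f 0 ⁻¹)) ·ₛ f

  recipPS-as-substitution : ∀ f → recipPS F f ≋ f 0 ⁻¹ ·ₛ (geometric ∘ₛ recipBase f)
  recipPS-as-substitution f n = *-cong refl (∑-cong n (λ k → sym (*-identityˡ _)))

  recipBase-constant : ∀ f → ¬ (f 0 ≈ 0#) → recipBase f 0 ≈ 0#
  recipBase-constant f f₀≉0 = trans (+-cong refl f₀⁻¹f₀≈-1) (-‿inverseʳ 1#)
    where
    f₀⁻¹f₀≈-1 : (- (f 0 ⁻¹)) * f 0 ≈ - 1#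
    f₀⁻¹f₀≈-1 = trans (sym (-‿distribˡ-* _ _))
                      (-‿cong (trans (*-comm _ _) (⁻¹-inverse _ f₀≉0)))

  recipBase-∘ₛ : ∀ f h → ¬ (f 0 ≈ 0#) → recipBase f ∘ₛ h ≋ recipBase (f ∘ₛ h)
  recipBase-∘ₛ f h f₀≉0 = ≋-trans (∘ₛ-+ₛ 1ₛ _ h)
    (+ₛ-cong (∘ₛ-const 1# h)
             (≋-trans (∘ₛ-·ₛ _ f h)
                      (·ₛ-cong (-‿cong (inverse-cong (sym (∘ₛ-constant f h)) f₀≉0)) (≋-refl {f ∘ₛ h}))))

  -- recipPS respects ≋ (it inspects f 0 through ⁻¹, so f 0 ≠ 0 is needed)
  recipPS-cong : ∀ {f g} → f ≋ g → ¬ (f 0 ≈ 0#) → recipPS F f ≋ recipPS F g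
  recipPS-cong {f} {g} f≋g f₀≉0 =
    ≋-trans (recipPS-as-substitution f)
      (≋-trans (·ₛ-cong f₀⁻¹≈g₀⁻¹ (∘ₛ-congʳ geometric
                  (+ₛ-cong (≋-refl {1ₛ}) (·ₛ-cong (-‿cong f₀⁻¹≈g₀⁻¹) f≋g))))
               (≋-sym (recipPS-as-substitution g)))
    where
    f₀⁻¹≈g₀⁻¹ : f 0 ⁻¹ ≈ g 0 ⁻¹
    f₀⁻¹≈g₀⁻¹ = inverse-cong (f≋g 0) f₀≉0

  -- 1/f ∘ h = 1/(f ∘ h), via associativity of substitution
  recipPS-∘ₛ : ∀ f h → ¬ (f 0 ≈ 0#) → h 0 ≈ 0# → recipPS F f ∘ₛ h ≋ recipPS F (f ∘ₛ h)
  recipPS-∘ₛ f h f₀≉0 h₀≈0 n = begin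
    (recipPS F f ∘ₛ h) n
      ≈⟨ ∘ₛ-congˡ h (recipPS-as-substitution f) n ⟩
    ((f 0 ⁻¹ ·ₛ (geometric ∘ₛ recipBase f)) ∘ₛ h) n
      ≈⟨ ∘ₛ-·ₛ (f 0 ⁻¹) (geometric ∘ₛ recipBase f) h n ⟩
    f 0 ⁻¹ * ((geometric ∘ₛ recipBase f) ∘ₛ h) n
      ≈⟨ *-cong refl (∘ₛ-assoc geometric (recipBase f) h (recipBase-constant f f₀≉0) h₀≈0 n) ⟩
    f 0 ⁻¹ * (geometric ∘ₛ (recipBase f ∘ₛ h)) n
      ≈⟨ *-cong (inverse-cong (sym (∘ₛ-constant f h)) f₀≉0)
                (∘ₛ-congʳ geometric (recipBase-∘ₛ f h f₀≉0) n) ⟩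
    (f ∘ₛ h) 0 ⁻¹ * (geometric ∘ₛ recipBase (f ∘ₛ h)) n
      ≈⟨ recipPS-as-substitution (f ∘ₛ h) n ⟨
    recipPS F (f ∘ₛ h) n ∎

  -- eᵗ − 1 and log(1+t) are inverse under substitution

  expm1 : Series
  expm1 zero    = 0#
  expm1 (suc k) = fact F (suc k) ⁻¹

  L : Series
  L = log1p F

  ι-fact⁻¹ : ∀ n → ι F (suc n) * fact F (suc n) ⁻¹ ≈ fact F n ⁻¹
  ι-fact⁻¹ n = inverse-unique (fact F n) _ (fact-nonzero n)
    (trans (sym (*-assoc _ _ _)) (⁻¹-inverse _ (fact-nonzero (suc n))))

  ∂expm1 : ∂ expm1 ≋ 1ₛ +ₛ expm1
  ∂expm1 zero    = trans (ι-fact⁻¹ 0) (trans inverse-one (sym (+-identityʳ _)))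
  ∂expm1 (suc n) = trans (ι-fact⁻¹ (suc n)) (sym (+-identityˡ _))

  log1p-coefficients : ∀ n → Σ[ s ∈ Carrier ]
    (L (suc n) ≡ s * ι F (suc n) ⁻¹) × (L (suc (suc n)) ≡ (- s) * ι F (suc (suc n)) ⁻¹)
  log1p-coefficients n = _ , ≡.refl , ≡.refl

  ∂-of-coefficient : ∀ n s → L (suc n) ≡ s * ι F (suc n) ⁻¹ → ∂ L n ≈ s
  ∂-of-coefficient n s L≡ = begin
    ι F (suc n) * L (suc n)              ≈⟨ *-cong refl (reflexive L≡) ⟩
    ι F (suc n) * (s * ι F (suc n) ⁻¹)   ≈⟨ *-rotate _ _ _ ⟩
    s * (ι F (suc n) * ι F (suc n) ⁻¹)   ≈⟨ *-cong refl (⁻¹-inverse _ (char-zero n)) ⟩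
    s * 1#                               ≈⟨ *-identityʳ s ⟩
    s                                    ∎

  ∂L-constant : ∂ L 0 ≈ 1#
  ∂L-constant = ∂-of-coefficient 0 1# ≡.refl

  ∂L-alternates : ∀ n → ∂ L (suc n) ≈ - ∂ L n
  ∂L-alternates n with log1p-coefficients n
  ... | s , L₁ , L₂ = trans (∂-of-coefficient (suc n) (- s) L₂)
                            (-‿cong (sym (∂-of-coefficient n s L₁)))

  ∂L-inverse : (1ₛ +ₛ X) *ₛ ∂ L ≋ 1ₛ
  ∂L-inverse n = trans (*ₛ-distribʳ (∂ L) 1ₛ X n)
                       (trans (+-cong (*ₛ-identityˡ (∂ L) n) refl) (coefficient n))
    where
    coefficient : ∀ n → ∂ L n + (X *ₛ ∂ L) n ≈ 1ₛ n
    coefficient zero    = trans (+-cong ∂L-constant (zeroˡ _))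
                                (+-identityʳ _)
    coefficient (suc n) = begin
      ∂ L (suc n) + (X *ₛ ∂ L) (suc n)   ≈⟨ +-cong (∂L-alternates n) (X-*ₛ-shift (∂ L) n) ⟩
      - ∂ L n + ∂ L n                    ≈⟨ -‿inverseˡ _ ⟩
      0#                                 ∎

  -- log(1+t) ∘ (eᵗ − 1) = t: both sides vanish at 0 and, by the chain rule,
  -- ∂(L ∘ (eᵗ−1)) = (∂L ∘ (eᵗ−1)) · eᵗ = ((1+t) ∂L) ∘ (eᵗ−1) = 1
  log1p∘expm1 : L ∘ₛ expm1 ≋ X
  log1p∘expm1 = ≋-by-derivative₁ (zeroˡ _) step
    where
    step : ∀ n → L ∘ₛ expm1 ≈[ n ] X → ∂ (L ∘ₛ expm1) n ≈ ∂ X n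
    step n _ = begin
      ∂ (L ∘ₛ expm1) n
        ≈⟨ ∂-∘ₛ L expm1 refl n ⟩
      ((∂ L ∘ₛ expm1) *ₛ ∂ expm1) n
        ≈⟨ *ₛ-congˡ (∂ L ∘ₛ expm1) ∂expm1 n ⟩
      ((∂ L ∘ₛ expm1) *ₛ (1ₛ +ₛ expm1)) n
        ≈⟨ *ₛ-congˡ (∂ L ∘ₛ expm1) (+ₛ-cong (∘ₛ-const 1# expm1) (X-∘ₛ expm1 refl)) n ⟨
      ((∂ L ∘ₛ expm1) *ₛ (1ₛ ∘ₛ expm1 +ₛ X ∘ₛ expm1)) n
        ≈⟨ *ₛ-comm (∂ L ∘ₛ expm1) _ n ⟩
      ((1ₛ ∘ₛ expm1 +ₛ X ∘ₛ expm1) *ₛ (∂ L ∘ₛ expm1)) n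
        ≈⟨ *ₛ-congʳ (∂ L ∘ₛ expm1) (∘ₛ-+ₛ 1ₛ X expm1) n ⟨
      (((1ₛ +ₛ X) ∘ₛ expm1) *ₛ (∂ L ∘ₛ expm1)) n
        ≈⟨ ∘ₛ-*ₛ (1ₛ +ₛ X) (∂ L) expm1 refl n ⟨
      (((1ₛ +ₛ X) *ₛ ∂ L) ∘ₛ expm1) n
        ≈⟨ ∘ₛ-congˡ expm1 ∂L-inverse n ⟩
      (1ₛ ∘ₛ expm1) n
        ≈⟨ ∘ₛ-const 1# expm1 n ⟩
      1ₛ n
        ≈⟨ ∂X n ⟨
      ∂ X n ∎

  ∘ₛ-log1p-expm1 : ∀ G → (G ∘ₛ L) ∘ₛ expm1 ≋ G
  ∘ₛ-log1p-expm1 G = ≋-trans (∘ₛ-assoc G L expm1 refl refl)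
                             (≋-trans (∘ₛ-congʳ G log1p∘expm1) (∘ₛ-X G))

  -- Stirling numbers: n! [tⁿ] (eᵗ − 1)ᵐ = m! S₂(n,m)

  -- proved by comparing coefficients in ∂((eᵗ−1)ᵐ⁺¹) = (m+1)(eᵗ−1)ᵐ(1 + (eᵗ−1))
  expm1-powers : ∀ n m → fact F n * (expm1 ^ₛ m) n ≈ fact F m * ι F (S₂ n m)
  expm1-powers zero    zero    = *-cong refl (sym ι-one)
  expm1-powers zero    (suc m) = trans (*-cong refl (zeroʳ _)) (trans (zeroʳ _) (sym (zeroʳ _)))
  expm1-powers (suc n) zero    = trans (zeroʳ _) (sym (zeroʳ _))
  expm1-powers (suc n) (suc m) = begin
    (n! * ι F (suc n)) * (expm1 ^ₛ suc m) (suc n)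
      ≈⟨ *-assoc _ _ _ ⟩
    n! * ∂ (expm1 ^ₛ suc m) n
      ≈⟨ *-cong refl (∂-^ₛ expm1 m n) ⟩
    n! * (i * (expm1 ^ₛ m *ₛ ∂ expm1) n)
      ≈⟨ *-cong refl (*-cong refl derivative-factor) ⟩
    n! * (i * ((expm1 ^ₛ m) n + (expm1 ^ₛ suc m) n))
      ≈⟨ distribute n! i _ _ ⟩
    i * (n! * (expm1 ^ₛ m) n + n! * (expm1 ^ₛ suc m) n)
      ≈⟨ *-cong refl (+-cong (expm1-powers n m) (expm1-powers n (suc m))) ⟩
    i * (m! * ι F (S₂ n m) + (m! * i) * ι F (S₂ n (suc m)))
      ≈⟨ collect m! i _ _ ⟩
    (m! * i) * (i * ι F (S₂ n (suc m)) + ι F (S₂ n m))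
      ≈⟨ *-cong refl recurrence ⟩
    (m! * i) * ι F (S₂ (suc n) (suc m)) ∎
    where
    n! = fact F n
    m! = fact F m
    i  = ι F (suc m)

    derivative-factor : (expm1 ^ₛ m *ₛ ∂ expm1) n ≈ (expm1 ^ₛ m) n + (expm1 ^ₛ suc m) n
    derivative-factor = begin
      (expm1 ^ₛ m *ₛ ∂ expm1) n                          ≈⟨ *ₛ-congˡ (expm1 ^ₛ m) ∂expm1 n ⟩
      (expm1 ^ₛ m *ₛ (1ₛ +ₛ expm1)) n                    ≈⟨ *ₛ-distribˡ (expm1 ^ₛ m) 1ₛ expm1 n ⟩
      (expm1 ^ₛ m *ₛ 1ₛ) n + (expm1 ^ₛ suc m) n          ≈⟨ +-cong (*ₛ-identityʳ (expm1 ^ₛ m) n) refl ⟩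
      (expm1 ^ₛ m) n + (expm1 ^ₛ suc m) n                ∎

    recurrence : i * ι F (S₂ n (suc m)) + ι F (S₂ n m) ≈ ι F (S₂ (suc n) (suc m))
    recurrence = sym (trans (ι-+ (suc m ℕ.* S₂ n (suc m)) (S₂ n m))
                            (+-cong (ι-* (suc m) (S₂ n (suc m))) refl))

    distribute : ∀ (f j a b : Carrier) → f * (j * (a + b)) ≈ j * (f * a + f * b)
    distribute = ScalarSolver.solve 4
      (λ f j a b → f :* (j :* (a :+ b)) := j :* (f :* a :+ f :* b)) refl
      where open ScalarSolver
    collect : ∀ (f j a b : Carrier) → j * (f * a + (f * j) * b) ≈ (f * j) * (j * b + a)
    collect = ScalarSolver.solve 4
      (λ f j a b → j :* (f :* a :+ (f :* j) :* b) := (f :* j) :* (j :* b :+ a)) refl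
      where open ScalarSolver

  ∘ₛ-expm1-coefficients : ∀ G n →
    fact F n * (G ∘ₛ expm1) n ≈ ∑ n (λ m → (fact F m * G m) * ι F (S₂ n m))
  ∘ₛ-expm1-coefficients G n = begin
    fact F n * ∑ n (λ m → G m * (expm1 ^ₛ m) n)
      ≈⟨ ∑-*ˡ n _ _ ⟩
    ∑ n (λ m → fact F n * (G m * (expm1 ^ₛ m) n))
      ≈⟨ ∑-cong n (λ m → *-rotate _ _ _) ⟩
    ∑ n (λ m → G m * (fact F n * (expm1 ^ₛ m) n))
      ≈⟨ ∑-cong n (λ m → *-cong refl (expm1-powers n m)) ⟩
    ∑ n (λ m → G m * (fact F m * ι F (S₂ n m)))
      ≈⟨ ∑-cong n (λ m → *-rotate-assoc _ _ _) ⟩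
    ∑ n (λ m → (fact F m * G m) * ι F (S₂ n m)) ∎

  -- The degenerate generating functions

  carlitz-denominator-constant : ∀ lam → (degPow F lam 1# +ₛ 1ₛ) 0 ≈ two F
  carlitz-denominator-constant lam = +-cong (trans (*-identityˡ _) inverse-one) refl

  carlitz∘log1p : ∀ r lam x → carlitzGF F r lam x ∘ₛ L ≋ changheeGF F r lam x
  carlitz∘log1p r lam x n = begin
    (((two F ·ₛ recipPS F A) ^ₛ r *ₛ Pₓ) ∘ₛ L) n
      ≈⟨ ∘ₛ-*ₛ ((two F ·ₛ recipPS F A) ^ₛ r) Pₓ L refl n ⟩
    (((two F ·ₛ recipPS F A) ^ₛ r) ∘ₛ L *ₛ Pₓ ∘ₛ L) n
      ≈⟨ *ₛ-congʳ (Pₓ ∘ₛ L) (∘ₛ-^ₛ (two F ·ₛ recipPS F A) L refl r) n ⟩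
    (((two F ·ₛ recipPS F A) ∘ₛ L) ^ₛ r *ₛ Pₓ ∘ₛ L) n
      ≈⟨ *ₛ-congʳ (Pₓ ∘ₛ L) (^ₛ-cong reciprocal r) n ⟩
    ((two F ·ₛ recipPS F B) ^ₛ r *ₛ Pₓ ∘ₛ L) n ∎
    where
    Pₓ A B : Series
    Pₓ = degPow F lam x
    A  = degPow F lam 1# +ₛ 1ₛ
    B  = 1ₛ +ₛ degPow F lam 1# ∘ₛ L

    A₀≉0 : ¬ (A 0 ≈ 0#)
    A₀≉0 A₀≈0 = two-nonzero (trans (sym (carlitz-denominator-constant lam)) A₀≈0)

    A∘L≋B : A ∘ₛ L ≋ B
    A∘L≋B n = trans (∘ₛ-+ₛ (degPow F lam 1#) 1ₛ L n)
                    (trans (+-cong refl (∘ₛ-const 1# L n)) (+-comm _ _))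

    reciprocal : (two F ·ₛ recipPS F A) ∘ₛ L ≋ two F ·ₛ recipPS F B
    reciprocal = ≋-trans (∘ₛ-·ₛ (two F) (recipPS F A) L)
      (·ₛ-cong refl (≋-trans (recipPS-∘ₛ A L A₀≉0 refl)
                             (recipPS-cong A∘L≋B (λ p → A₀≉0 (trans (sym (∘ₛ-constant A L)) p)))))

  carlitz-via-changhee : ∀ r lam x → carlitzGF F r lam x ≋ changheeGF F r lam x ∘ₛ expm1
  carlitz-via-changhee r lam x =
    ≋-trans (≋-sym (∘ₛ-log1p-expm1 (carlitzGF F r lam x)))
            (∘ₛ-congˡ expm1 (carlitz∘log1p r lam x))

theorem2p10 : ∀ {c ℓ : Level} (F : CharZeroField c ℓ) (lam : CharZeroField.Carrier F)
    → ¬ (CharZeroField._≈_ F lam (CharZeroField.0# F))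
    → (r n : ℕ) (x : CharZeroField.Carrier F)
    → CharZeroField._≈_ F (degEuler F r lam n x)
        (sumTo F n (λ m → CharZeroField._*_ F (changhee F r lam m x) (ι F (S₂ n m))))
theorem2p10 F lam _ r n x = begin
  fact F n * carlitzGF F r lam x n
    ≈⟨ *-cong refl (carlitz-via-changhee r lam x n) ⟩
  fact F n * (changheeGF F r lam x ∘ₛ expm1) n
    ≈⟨ ∘ₛ-expm1-coefficients (changheeGF F r lam x) n ⟩
  sumTo F n (λ m → changhee F r lam m x * ι F (S₂ n m)) ∎
  where
  open CharZeroField F
  open FormalPowerSeries F
  open SetoidReasoning setoid
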